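{- Let $k \geq 2$ and $q \geq 1$ be integers. Let $V_{k,q} = \{ \mathbf{a} \in \mathbb{Z}^k : \mathbf{a} \geq 0,\ \sum_{i=1}^k a_i = q\}$ and let $E_{k,q} = \{ e(\mathbf{b}) : \mathbf{b} \in \mathbb{Z}^k,\ \mathbf{b} \geq 0,\ \sum_{i=1}^k b_i = q-1\}$, where $e(\mathbf{b}) = \{\mathbf{b}+\mathbf{e}_1, \mathbf{b}+\mathbf{e}_2, \ldots, \mathbf{b}+\mathbf{e}_k\}$ and $\mathbf{e}_i$ is the $i$-th standard basis vector of $\mathbb{R}^k$. Call a labeling $\ell : V_{k,q} \to [k]$ Sperner-admissible if for every $\mathbf{a} \in V_{k,q}$, $\ell(\mathbf{a}) = j$ implies $a_j > 0$. Then for every Sperner-admissible labeling $\ell$, there are at least $\binom{q+k-3}{k-2}$ hyperedges $e \in E_{k,q}$ that are non-monochromatic under $\ell$ (i.e. whose vertices do not all receive the same label).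
   Context: $[k] = \{1,\ldots,k\}$. The hypergraph $H_{k,q} = (V_{k,q}, E_{k,q})$ is the "Simplex-Lattice Hypergraph"; its hyperedges are called cells. -}

module Defs where

open import Data.Nat using (ℕ; suc; _<_)
open import Data.Fin using (Fin)
open import Data.Vec using (Vec; lookup; updateAt; sum)
open import Data.Product using (∃; _×_)
open import Relation.Binary.PropositionalEquality using (_≡_)
open import Relation.Nullary using (¬_)

-- Points of ℤ^k with nonnegative coordinates are represented as Vec ℕ k.
-- V_{k,q}: a with Σ a_i = q.
IsVertex : (k q : ℕ) → Vec ℕ k → Set
IsVertex k q a = sum a ≡ q

_+e_ : ∀ {k} → Vec ℕ k → Fin k → Vec ℕ k
b +e i = updateAt b i suc

-- A labeling is a map from points to [k] = Fin k; only its values on V_{k,q} matter.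
Labeling : ℕ → Set
Labeling k = Vec ℕ k → Fin k

SpernerAdmissible : (k q : ℕ) → Labeling k → Set
SpernerAdmissible k q ℓ = ∀ (a : Vec ℕ k) → IsVertex k q a → ∀ (j : Fin k) → ℓ a ≡ j → 0 < lookup a j

Monochromatic : ∀ {k} → Labeling k → Vec ℕ k → Set
Monochromatic {k} ℓ b = ∃ λ (j : Fin k) → ∀ (i : Fin k) → ℓ (b +e i) ≡ j

NonMonochromatic : ∀ {k} → Labeling k → Vec ℕ k → Set
NonMonochromatic ℓ b = ¬ Monochromatic ℓ b

-- The cells e(b) are indexed by the compositions b of q − 1 into k parts, of which there are
-- C(q+k−2, k−1). If e(b) is monochromatic of colour c, then some vertex b + e_i with i ≠ c has
-- label c, so admissibility gives b_c > 0 and b − e_c is a composition of q − 2. This peeling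
-- map is injective on monochromatic cells: if b − e_c = b' − e_c', then b + e_c' = b' + e_c is a
-- common vertex, labelled both c and c', so c = c' and b = b'. Hence at most C(q+k−3, k−1) cells
-- are monochromatic, and Pascal's rule leaves at least C(q+k−3, k−2) non-monochromatic ones.
module Submission where

open import Defs
open import Data.Nat using (ℕ; zero; suc; pred; _≤_; _<_; _+_; _∸_; z≤n; s≤s; >-nonZero)
open import Data.Nat.Properties
  using (suc-injective; suc-pred; +-suc; +-comm; +-∸-assoc; +-cancelʳ-≤; +-monoˡ-≤; ≤-trans; module ≤-Reasoning)
open import Data.Nat.Combinatorics using (_C_; nCn≡1; nCk+nC[k+1]≡[n+1]C[k+1])
open import Data.Fin using (Fin; _≟_) renaming (zero to fzero; suc to fsuc)
open import Data.Fin.Properties using (all?)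
open import Data.Vec using (Vec; []; _∷_; lookup; updateAt; sum)
open import Data.Vec.Properties using (updateAt-updateAt; updateAt-id-local; updateAt-commutes; lookup∘updateAt′)
open import Data.List using (List; []; _∷_; _++_; length; map; filter)
open import Data.List.Properties using (length-++; length-map; length-removeAt′)
open import Data.List.Membership.Propositional using (_∈_)
open import Data.List.Membership.Propositional.Properties using (∈-map⁺; ∈-map⁻; ∈-++⁺ˡ; ∈-++⁺ʳ; ∈-++⁻; ∈-filter⁻)
open import Data.List.Relation.Unary.Any using (here; there; index; _─_)
open import Data.List.Relation.Unary.All using (All; []; _∷_; tabulate)
import Data.List.Relation.Unary.All as All
open import Data.List.Relation.Unary.AllPairs using ([]; _∷_)
open import Data.List.Relation.Unary.Unique.Propositional using (Unique)
import Data.List.Relation.Unary.Unique.Propositional.Properties as Unique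
open import Data.Product using (∃; _×_; _,_; proj₁; proj₂)
open import Data.Sum using (inj₁; inj₂)
open import Data.Empty using (⊥-elim)
open import Relation.Nullary using (¬_; yes; no; contradiction)
open import Relation.Nullary.Decidable using (map′)
open import Relation.Unary using (Decidable)
open import Relation.Unary.Properties using (∁?)
open import Relation.Binary.PropositionalEquality using (_≡_; _≢_; refl; sym; trans; cong; cong₂; subst; module ≡-Reasoning)

private
  variable
    A B : Set

∈-─⁺ : ∀ {x y : A} {ys : List A} (x∈ys : x ∈ ys) → y ∈ ys → y ≢ x → y ∈ (ys ─ x∈ys)
∈-─⁺ (here refl) (here refl) y≢x = ⊥-elim (y≢x refl)
∈-─⁺ (here refl) (there y∈ys) _ = y∈ys
∈-─⁺ (there x∈ys) (here y≡z) _ = here y≡z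
∈-─⁺ (there x∈ys) (there y∈ys) y≢x = there (∈-─⁺ x∈ys y∈ys y≢x)

length-≤-injectiveOn : (f : A → B) {xs : List A} {ys : List B} → Unique xs →
  (∀ {x} → x ∈ xs → f x ∈ ys) →
  (∀ {x y} → x ∈ xs → y ∈ xs → f x ≡ f y → x ≡ y) →
  length xs ≤ length ys
length-≤-injectiveOn f {[]} _ _ _ = z≤n
length-≤-injectiveOn f {x ∷ xs} {ys} (x∉xs ∷ unique) maps injective =
  subst (suc (length xs) ≤_) (sym (length-removeAt′ ys (index fx∈ys)))
    (s≤s (length-≤-injectiveOn f unique maps′ (λ p q → injective (there p) (there q))))
  where
  fx∈ys : f x ∈ ys
  fx∈ys = maps (here refl)
  maps′ : ∀ {y} → y ∈ xs → f y ∈ (ys ─ fx∈ys)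
  maps′ y∈xs = ∈-─⁺ fx∈ys (maps (there y∈xs))
    (λ fy≡fx → All.lookup x∉xs y∈xs (sym (injective (there y∈xs) (here refl) fy≡fx)))

length-filter+length-filter-∁ : ∀ {P : A → Set} (P? : Decidable P) (xs : List A) →
  length (filter P? xs) + length (filter (∁? P?) xs) ≡ length xs
length-filter+length-filter-∁ P? [] = refl
length-filter+length-filter-∁ P? (x ∷ xs) with P? x
... | yes _ = cong suc (length-filter+length-filter-∁ P? xs)
... | no _ = trans (+-suc _ _) (cong suc (length-filter+length-filter-∁ P? xs))

_-e_ : ∀ {k} → Vec ℕ k → Fin k → Vec ℕ k
b -e i = updateAt b i pred

sum-+e : ∀ {k} (v : Vec ℕ k) (i : Fin k) → sum (v +e i) ≡ suc (sum v)
sum-+e (x ∷ v) fzero = refl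
sum-+e (x ∷ v) (fsuc i) = trans (cong (x +_) (sum-+e v i)) (+-suc x (sum v))

-e-+e : ∀ {k} (v : Vec ℕ k) (i : Fin k) → 0 < lookup v i → (v -e i) +e i ≡ v
-e-+e v i vᵢ>0 =
  trans (updateAt-updateAt i v) (updateAt-id-local i v (suc-pred _ {{>-nonZero vᵢ>0}}))

+e-comm : ∀ {k} (v : Vec ℕ k) (i j : Fin k) → (v +e i) +e j ≡ (v +e j) +e i
+e-comm v i j with i ≟ j
... | yes refl = refl
... | no i≢j = updateAt-commutes j i (λ j≡i → i≢j (sym j≡i)) v

compositions : (k n : ℕ) → List (Vec ℕ k)
compositions zero zero = [] ∷ []
compositions zero (suc n) = []
compositions (suc k) zero = map (0 ∷_) (compositions k zero)
compositions (suc k) (suc n) =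
  map (0 ∷_) (compositions k (suc n)) ++ map (_+e fzero) (compositions (suc k) n)

length-compositions : ∀ k n → length (compositions (suc k) n) ≡ (n + k) C k
length-compositions zero zero = refl
length-compositions zero (suc n) =
  trans (length-map (_+e fzero) (compositions 1 n)) (length-compositions zero n)
length-compositions (suc k) zero =
  trans (length-map (0 ∷_) (compositions (suc k) zero))
        (trans (length-compositions k zero) (trans (nCn≡1 k) (sym (nCn≡1 (suc k)))))
length-compositions (suc k) (suc n) = begin
  length (map (0 ∷_) (compositions (suc k) (suc n)) ++ map (_+e fzero) (compositions (2 + k) n))
    ≡⟨ length-++ (map (0 ∷_) (compositions (suc k) (suc n))) ⟩
  length (map (0 ∷_) (compositions (suc k) (suc n))) + length (map (_+e fzero) (compositions (2 + k) n))
    ≡⟨ cong₂ _+_ (length-map (0 ∷_) (compositions (suc k) (suc n))) (length-map (_+e fzero) (compositions (2 + k) n)) ⟩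
  length (compositions (suc k) (suc n)) + length (compositions (2 + k) n)
    ≡⟨ cong₂ _+_ (length-compositions k (suc n)) (length-compositions (suc k) n) ⟩
  (suc n + k) C k + (n + suc k) C suc k
    ≡⟨ cong (λ t → (suc n + k) C k + t C suc k) (+-suc n k) ⟩
  (suc n + k) C k + (suc n + k) C suc k
    ≡⟨ nCk+nC[k+1]≡[n+1]C[k+1] (suc n + k) k ⟩
  suc (suc n + k) C suc k
    ≡⟨ cong (λ t → suc t C suc k) (+-suc n k) ⟨
  (suc n + suc k) C suc k
    ∎
  where open ≡-Reasoning

∈-compositions⁻ : ∀ k n {v} → v ∈ compositions k n → sum v ≡ n
∈-compositions⁻ zero zero (here refl) = refl
∈-compositions⁻ (suc k) zero v∈ with ∈-map⁻ (0 ∷_) v∈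
... | w , w∈ , refl = ∈-compositions⁻ k zero w∈
∈-compositions⁻ (suc k) (suc n) v∈ with ∈-++⁻ (map (0 ∷_) (compositions k (suc n))) v∈
... | inj₁ v∈₀ with ∈-map⁻ (0 ∷_) v∈₀
...   | w , w∈ , refl = ∈-compositions⁻ k (suc n) w∈
∈-compositions⁻ (suc k) (suc n) v∈ | inj₂ v∈₊ with ∈-map⁻ (_+e fzero) v∈₊
...   | _ ∷ _ , w∈ , refl = cong suc (∈-compositions⁻ (suc k) n w∈)

∈-compositions⁺ : ∀ k n (v : Vec ℕ k) → sum v ≡ n → v ∈ compositions k n
∈-compositions⁺ zero zero [] _ = here refl
∈-compositions⁺ (suc k) zero (zero ∷ v) Σv≡0 = ∈-map⁺ (0 ∷_) (∈-compositions⁺ k zero v Σv≡0)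
∈-compositions⁺ (suc k) (suc n) (zero ∷ v) Σv≡n = ∈-++⁺ˡ (∈-map⁺ (0 ∷_) (∈-compositions⁺ k (suc n) v Σv≡n))
∈-compositions⁺ (suc k) (suc n) (suc x ∷ v) Σv≡n =
  ∈-++⁺ʳ (map (0 ∷_) (compositions k (suc n)))
    (∈-map⁺ (_+e fzero) (∈-compositions⁺ (suc k) n (x ∷ v) (suc-injective Σv≡n)))

compositions-unique : ∀ k n → Unique (compositions k n)
compositions-unique zero zero = [] ∷ []
compositions-unique zero (suc n) = []
compositions-unique (suc k) zero = Unique.map⁺ (λ { refl → refl }) (compositions-unique k zero)
compositions-unique (suc k) (suc n) =
  Unique.++⁺ (Unique.map⁺ (λ { refl → refl }) (compositions-unique k (suc n)))
             (Unique.map⁺ +e₀-injective (compositions-unique (suc k) n))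
             disjoint
  where
  +e₀-injective : ∀ {v w : Vec ℕ (suc k)} → v +e fzero ≡ w +e fzero → v ≡ w
  +e₀-injective {_ ∷ _} {_ ∷ _} refl = refl
  disjoint : ∀ {v} → ¬ (v ∈ map (0 ∷_) (compositions k (suc n)) × v ∈ map (_+e fzero) (compositions (suc k) n))
  disjoint (v∈₀ , v∈₊) with ∈-map⁻ (0 ∷_) v∈₀ | ∈-map⁻ (_+e fzero) v∈₊
  ... | _ , _ , refl | (_ ∷ _) , _ , ()

module _ {m : ℕ} (ℓ : Labeling (2 + m)) where

  colour : Vec ℕ (2 + m) → Fin (2 + m)
  colour b = ℓ (b +e fzero)

  Monochromatic⇒colour : ∀ {b} → Monochromatic ℓ b → ∀ i → ℓ (b +e i) ≡ colour b
  Monochromatic⇒colour (j , h) i = trans (h i) (sym (h fzero))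

  monochromatic? : Decidable (Monochromatic ℓ)
  monochromatic? b = map′ (colour b ,_) Monochromatic⇒colour (all? (λ i → ℓ (b +e i) ≟ colour b))

  monochromatic-colour-positive : ∀ {p b c} → SpernerAdmissible (2 + m) (suc p) ℓ → sum b ≡ p →
    (∀ i → ℓ (b +e i) ≡ c) → 0 < lookup b c
  monochromatic-colour-positive {b = b} {c} admissible Σb≡p h =
    subst (0 <_) (lookup∘updateAt′ c i c≢i b)
      (admissible (b +e i) (trans (sum-+e b i) (cong suc Σb≡p)) c (h i))
    where
    other : (c : Fin (2 + m)) → ∃ λ i → c ≢ i
    other fzero = fsuc fzero , λ ()
    other (fsuc _) = fzero , λ ()
    i : Fin (2 + m)
    i = proj₁ (other c)
    c≢i : c ≢ i
    c≢i = proj₂ (other c)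

  peel : Vec ℕ (2 + m) → Vec ℕ (2 + m)
  peel b = b -e colour b

  monochromatic-peel-injective : ∀ {b b' c c'} → 0 < lookup b c → 0 < lookup b' c' →
    (∀ i → ℓ (b +e i) ≡ c) → (∀ i → ℓ (b' +e i) ≡ c') → b -e c ≡ b' -e c' → b ≡ b'
  monochromatic-peel-injective {b} {b'} {c} {c'} b꜀>0 b'꜀'>0 h h' peeled≡ = begin
    b                ≡⟨ -e-+e b c b꜀>0 ⟨
    (b -e c) +e c    ≡⟨ cong₂ _+e_ peeled≡ c≡c' ⟩
    (b' -e c') +e c' ≡⟨ -e-+e b' c' b'꜀'>0 ⟩
    b'               ∎
    where
    open ≡-Reasoning
    shared : b +e c' ≡ b' +e c
    shared = begin
      b +e c'                  ≡⟨ cong (_+e c') (-e-+e b c b꜀>0) ⟨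
      ((b -e c) +e c) +e c'    ≡⟨ +e-comm (b -e c) c c' ⟩
      ((b -e c) +e c') +e c    ≡⟨ cong (λ v → (v +e c') +e c) peeled≡ ⟩
      ((b' -e c') +e c') +e c  ≡⟨ cong (_+e c) (-e-+e b' c' b'꜀'>0) ⟩
      b' +e c                  ∎
    c≡c' : c ≡ c'
    c≡c' = trans (sym (h c')) (trans (cong ℓ shared) (h' c))

  monochromaticCells nonMonochromaticCells : ℕ → List (Vec ℕ (2 + m))
  monochromaticCells p = filter monochromatic? (compositions (2 + m) p)
  nonMonochromaticCells p = filter (∁? monochromatic?) (compositions (2 + m) p)

  module _ {p : ℕ} (admissible : SpernerAdmissible (2 + m) (suc p) ℓ) where

    ∈-monochromaticCells⁻ : ∀ {b} → b ∈ monochromaticCells p →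
      sum b ≡ p × 0 < lookup b (colour b) × (∀ i → ℓ (b +e i) ≡ colour b)
    ∈-monochromaticCells⁻ {b} b∈ with ∈-filter⁻ monochromatic? b∈
    ... | b∈cells , mono = Σb≡p , monochromatic-colour-positive admissible Σb≡p h , h
      where
      Σb≡p : sum b ≡ p
      Σb≡p = ∈-compositions⁻ (2 + m) p b∈cells
      h : ∀ i → ℓ (b +e i) ≡ colour b
      h = Monochromatic⇒colour mono

    sum-peel : ∀ {b} → b ∈ monochromaticCells p → suc (sum (peel b)) ≡ p
    sum-peel {b} b∈ with ∈-monochromaticCells⁻ b∈
    ... | Σb≡p , b꜀>0 , _ =
      trans (sym (sum-+e (peel b) (colour b))) (trans (cong sum (-e-+e b (colour b) b꜀>0)) Σb≡p)

    peel-injectiveOn : ∀ {b b'} → b ∈ monochromaticCells p → b' ∈ monochromaticCells p →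
      peel b ≡ peel b' → b ≡ b'
    peel-injectiveOn b∈ b'∈ with ∈-monochromaticCells⁻ b∈ | ∈-monochromaticCells⁻ b'∈
    ... | _ , b꜀>0 , h | _ , b'꜀'>0 , h' = monochromatic-peel-injective b꜀>0 b'꜀'>0 h h'

    monochromaticCells-unique : Unique (monochromaticCells p)
    monochromaticCells-unique = Unique.filter⁺ monochromatic? (compositions-unique (2 + m) p)

  length-monochromaticCells-≤ : ∀ p → SpernerAdmissible (2 + m) (suc p) ℓ →
    length (monochromaticCells p) ≤ (p + m) C suc m
  -- For q = 1 there is no composition of q − 2 to peel into, so no cell is monochromatic.
  length-monochromaticCells-≤ zero admissible =
    ≤-trans (length-≤-injectiveOn peel {ys = []} (monochromaticCells-unique admissible)
              (λ b∈ → contradiction (sum-peel admissible b∈) λ ())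
              (peel-injectiveOn admissible))
            z≤n
  length-monochromaticCells-≤ (suc r) admissible =
    subst (length (monochromaticCells (suc r)) ≤_)
          (trans (length-compositions (suc m) r) (cong (_C suc m) (+-suc r m)))
          (length-≤-injectiveOn peel (monochromaticCells-unique admissible)
            (λ b∈ → ∈-compositions⁺ (2 + m) r _ (suc-injective (sum-peel admissible b∈)))
            (peel-injectiveOn admissible))

  length-nonMonochromaticCells-≥ : ∀ p → SpernerAdmissible (2 + m) (suc p) ℓ →
    (p + m) C m ≤ length (nonMonochromaticCells p)
  length-nonMonochromaticCells-≥ p admissible = +-cancelʳ-≤ ((p + m) C suc m) _ _ (begin
    (p + m) C m + (p + m) C suc m
      ≡⟨ nCk+nC[k+1]≡[n+1]C[k+1] (p + m) m ⟩
    suc (p + m) C suc m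
      ≡⟨ cong (_C suc m) (+-suc p m) ⟨
    (p + suc m) C suc m
      ≡⟨ length-compositions (suc m) p ⟨
    length (compositions (2 + m) p)
      ≡⟨ length-filter+length-filter-∁ monochromatic? (compositions (2 + m) p) ⟨
    length (monochromaticCells p) + length (nonMonochromaticCells p)
      ≤⟨ +-monoˡ-≤ _ (length-monochromaticCells-≤ p admissible) ⟩
    (p + m) C suc m + length (nonMonochromaticCells p)
      ≡⟨ +-comm ((p + m) C suc m) _ ⟩
    length (nonMonochromaticCells p) + (p + m) C suc m
      ∎)
    where open ≤-Reasoning

proposition1 : ∀ (k q : ℕ) → 2 ≤ k → 1 ≤ q → (ℓ : Labeling k) → SpernerAdmissible k q ℓ →
    ∃ λ (bs : List (Vec ℕ k)) →
      Unique bs × All (λ b → sum b ≡ q ∸ 1 × NonMonochromatic ℓ b) bs × ((q + k ∸ 3) C (k ∸ 2)) ≤ length bs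
proposition1 (suc (suc m)) (suc p) (s≤s (s≤s z≤n)) (s≤s z≤n) ℓ admissible =
  nonMonochromaticCells ℓ p ,
  Unique.filter⁺ (∁? (monochromatic? ℓ)) (compositions-unique (2 + m) p) ,
  tabulate cell-properties ,
  subst (λ n → n C m ≤ length (nonMonochromaticCells ℓ p))
        (sym (+-∸-assoc p {2 + m} (s≤s (s≤s z≤n))))
        (length-nonMonochromaticCells-≥ ℓ p admissible)
  where
  cell-properties : ∀ {b} → b ∈ nonMonochromaticCells ℓ p → sum b ≡ p × NonMonochromatic ℓ b
  cell-properties b∈ with ∈-filter⁻ (∁? (monochromatic? ℓ)) b∈
  ... | b∈cells , nonMono = ∈-compositions⁻ (2 + m) p b∈cells , nonMono
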